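{- Let $\mathbf{M}=\langle M,+,\vee,\wedge,0,1,-1\rangle$ be a unital commutative distributive $\ell$-monoid. The following are equivalent: (1) $\mathbf{M}$ is cancellative, i.e.\ for all $x,y,z\in M$, $x+z=y+z$ implies $x=y$; (2) for all $x,y,z\in\{w\in M\mid 0\leq w\leq 1\}$, if $x+z=y+z$ then $x=y$; (3) for all $x,y,z\in\Gamma(\mathbf{M})$, if $x\oplus z=y\oplus z$ and $x\odot z=y\odot z$ then $x=y$.
   Context: A unital commutative distributive $\ell$-monoid is an algebra $\langle M,+,\vee,\wedge,0,1,-1\rangle$ (arities $2,2,2,0,0,0$) such that: $\langle M,\vee,\wedge\rangle$ is a distributive lattice; $\langle M,+,0\rangle$ is a commutative monoid; $+$ distributes over $\vee$ and $\wedge$; $-1+1=0$; $-1\leq 0\leq 1$ (with $\leq$ the lattice order); and for every $x\in M$ there is $n\in\mathbb{N}\setminus\{0\}$ with $(-1)+\dots+(-1)\leq x\leq 1+\dots+1$ ($n$ summands each). $\Gamma(\mathbf{M})$ denotes the set $\{x\in M\mid 0\leq x\leq 1\}$ equipped with $x\oplus y=(x+y)\wedge 1$ and $x\odot y=(x+y+(-1))\vee 0$ (together with the restricted $\vee,\wedge,0,1$). -}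

module Defs where

open import Level using (Level; suc)
open import Data.Nat using (ℕ; zero) renaming (suc to sucℕ)
open import Data.Product using (Σ; _×_; ∃)
open import Relation.Binary.PropositionalEquality using (_≡_)

times : ∀ {a} {M : Set a} → (M → M → M) → M → ℕ → M → M
times _+_ z zero     x = z
times _+_ z (sucℕ n) x = x + times _+_ z n x

record UCDLMonoid (a : Level) : Set (suc a) where
  infixl 6 _+_
  infixr 5 _∨_
  infixr 6 _∧_
  field
    M    : Set a
    _+_  : M → M → M
    _∨_  : M → M → M
    _∧_  : M → M → M
    𝟘    : M
    𝟙    : M
    -𝟙   : M
    ∨-assoc  : ∀ x y z → (x ∨ y) ∨ z ≡ x ∨ (y ∨ z)
    ∨-comm   : ∀ x y → x ∨ y ≡ y ∨ x
    ∧-assoc  : ∀ x y z → (x ∧ y) ∧ z ≡ x ∧ (y ∧ z)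
    ∧-comm   : ∀ x y → x ∧ y ≡ y ∧ x
    ∨-absorb : ∀ x y → x ∨ (x ∧ y) ≡ x
    ∧-absorb : ∀ x y → x ∧ (x ∨ y) ≡ x
    ∧-distrib-∨ : ∀ x y z → x ∧ (y ∨ z) ≡ (x ∧ y) ∨ (x ∧ z)
    +-assoc  : ∀ x y z → (x + y) + z ≡ x + (y + z)
    +-comm   : ∀ x y → x + y ≡ y + x
    +-identityˡ : ∀ x → 𝟘 + x ≡ x
    +-distrib-∨ : ∀ x y z → x + (y ∨ z) ≡ (x + y) ∨ (x + z)
    +-distrib-∧ : ∀ x y z → x + (y ∧ z) ≡ (x + y) ∧ (x + z)
    -𝟙+𝟙 : -𝟙 + 𝟙 ≡ 𝟘
    -𝟙≤𝟘 : -𝟙 ∧ 𝟘 ≡ -𝟙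
    𝟘≤𝟙  : 𝟘 ∧ 𝟙 ≡ 𝟘
    -- strong unit: -1+...+-1 ≤ x ≤ 1+...+1 with n ≥ 1 summands (≤ is x ∧ y ≡ x)
    unital : ∀ x → Σ ℕ λ n →
      ((times _+_ 𝟘 (sucℕ n) -𝟙) ∧ x ≡ times _+_ 𝟘 (sucℕ n) -𝟙) ×
      (x ∧ times _+_ 𝟘 (sucℕ n) 𝟙 ≡ x)

  _≤_ : M → M → Set a
  x ≤ y = x ∧ y ≡ x


  InΓ : M → Set a
  InΓ x = (𝟘 ≤ x) × (x ≤ 𝟙)

  _⊕_ : M → M → M
  x ⊕ y = (x + y) ∧ 𝟙

  _⊙_ : M → M → M
  x ⊙ y = ((x + y) + -𝟙) ∨ 𝟘

  Cancellative : Set a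
  Cancellative = ∀ x y z → x + z ≡ y + z → x ≡ y

  CancellativeOnUnit : Set a
  CancellativeOnUnit = ∀ x y z → InΓ x → InΓ y → InΓ z → x + z ≡ y + z → x ≡ y

  ΓCancellative : Set a
  ΓCancellative = ∀ x y z → InΓ x → InΓ y → InΓ z →
                  x ⊕ z ≡ y ⊕ z → x ⊙ z ≡ y ⊙ z → x ≡ y

TFAE₃ : ∀ {a} → Set a → Set a → Set a → Set a
TFAE₃ P Q R = ((P → Q) × (Q → R)) × (R → P)

{-# OPTIONS --safe #-}
-- Write n·𝟙 for 𝟙 + ⋯ + 𝟙, whose inverse is n·-𝟙, and u ⁺ = u ∨ 𝟘.
-- (2) ⇒ (3): x ⊕ z and (x ⊙ z) + 𝟙 are the meet and the join of x + z with 𝟙, and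
-- in a distributive lattice an element is determined by its meet and join with a
-- fixed element.
-- (2) ⇒ (1): first, every z ∈ Γ is cancellable.  Shifting by an invertible k·𝟙 puts
-- x and y into [𝟘, n·𝟙]; there x is determined by x ∧ (n-1)·𝟙, which falls to
-- induction on n, and by x ∨ (n-1)·𝟙, which is recovered from the element
-- (x + (n-1)·-𝟙) ⁺ of Γ.  Then every z is cancellable: after a shift z lies in
-- [𝟘, n·𝟙] and splits as (z ∧ 𝟙) + (z + -𝟙) ⁺, a sum of an element of Γ and an
-- element of [𝟘, (n-1)·𝟙].
module Submission where

open import Defs
open import Level using (Level)
open import Algebra.Bundles using (CommutativeSemigroup)
import Algebra.Properties.CommutativeSemigroup as CommutativeSemigroupProperties
open import Data.Nat using (ℕ; zero; suc) renaming (_+_ to _+ℕ_)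
open import Data.Nat.Properties using () renaming (+-comm to +ℕ-comm)
open import Data.Product using (∃; _×_; _,_)
open import Relation.Binary.PropositionalEquality
open import Function using (_∘_)

module UCDLMonoidProperties {a : Level} (𝐌 : UCDLMonoid a) where
  open UCDLMonoid 𝐌 renaming (_≤_ to infix 4 _≤_)
  open ≡-Reasoning

  ∧-idem : ∀ x → x ∧ x ≡ x
  ∧-idem x = trans (cong (x ∧_) (sym (∨-absorb x x))) (∧-absorb x (x ∧ x))

  ≤-trans : ∀ {x y z} → x ≤ y → y ≤ z → x ≤ z
  ≤-trans {x} {y} {z} x≤y y≤z = begin
    x ∧ z        ≡⟨ cong (_∧ z) x≤y ⟨
    (x ∧ y) ∧ z  ≡⟨ ∧-assoc x y z ⟩
    x ∧ (y ∧ z)  ≡⟨ cong (x ∧_) y≤z ⟩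
    x ∧ y        ≡⟨ x≤y ⟩
    x            ∎

  ≤-antisym : ∀ {x y} → x ≤ y → y ≤ x → x ≡ y
  ≤-antisym {x} {y} x≤y y≤x = trans (sym x≤y) (trans (∧-comm x y) y≤x)

  x∧y≤y : ∀ x y → x ∧ y ≤ y
  x∧y≤y x y = trans (∧-assoc x y y) (cong (x ∧_) (∧-idem y))

  x∧y≤x : ∀ x y → x ∧ y ≤ x
  x∧y≤x x y = subst (_≤ x) (∧-comm y x) (x∧y≤y y x)

  ∧-greatest : ∀ {x y z} → z ≤ x → z ≤ y → z ≤ x ∧ y
  ∧-greatest {x} {y} {z} z≤x z≤y = trans (sym (∧-assoc z x y)) (trans (cong (_∧ y) z≤x) z≤y)

  y≤x∨y : ∀ x y → y ≤ x ∨ y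
  y≤x∨y x y = trans (cong (y ∧_) (∨-comm x y)) (∧-absorb y x)

  x≤x∨y : ∀ x y → x ≤ x ∨ y
  x≤x∨y x y = subst (x ≤_) (∨-comm y x) (y≤x∨y y x)

  ∧-distribʳ-∨ : ∀ x y z → (x ∨ y) ∧ z ≡ (x ∧ z) ∨ (y ∧ z)
  ∧-distribʳ-∨ x y z = trans (∧-comm (x ∨ y) z) (trans (∧-distrib-∨ z x y) (cong₂ _∨_ (∧-comm z x) (∧-comm z y)))

  ∨-least : ∀ {x y z} → x ≤ z → y ≤ z → x ∨ y ≤ z
  ∨-least {x} {y} {z} x≤z y≤z = trans (∧-distribʳ-∨ x y z) (cong₂ _∨_ x≤z y≤z)

  ∧-∨-cancel : ∀ {x y z} → x ∧ z ≡ y ∧ z → x ∨ z ≡ y ∨ z → x ≡ y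
  ∧-∨-cancel {x} {y} {z} ∧-eq ∨-eq = begin
    x                  ≡⟨ ∧-absorb x z ⟨
    x ∧ (x ∨ z)        ≡⟨ cong (x ∧_) ∨-eq ⟩
    x ∧ (y ∨ z)        ≡⟨ ∧-distrib-∨ x y z ⟩
    (x ∧ y) ∨ (x ∧ z)  ≡⟨ cong₂ _∨_ (∧-comm x y) ∧-eq ⟩
    (y ∧ x) ∨ (y ∧ z)  ≡⟨ ∧-distrib-∨ y x z ⟨
    y ∧ (x ∨ z)        ≡⟨ cong (y ∧_) ∨-eq ⟩
    y ∧ (y ∨ z)        ≡⟨ ∧-absorb y z ⟩
    y                  ∎

  +-commutativeSemigroup : CommutativeSemigroup a a
  +-commutativeSemigroup = record
    { _∙_ = _+_
    ; isCommutativeSemigroup = record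
      { isSemigroup = record
        { isMagma = record { isEquivalence = isEquivalence ; ∙-cong = cong₂ _+_ }
        ; assoc = +-assoc
        }
      ; comm = +-comm
      }
    }

  open CommutativeSemigroupProperties +-commutativeSemigroup using (interchange; xy∙z≈xz∙y)

  +-identityʳ : ∀ x → x + 𝟘 ≡ x
  +-identityʳ x = trans (+-comm x 𝟘) (+-identityˡ x)

  +-distribʳ-∧ : ∀ x y z → (x ∧ y) + z ≡ (x + z) ∧ (y + z)
  +-distribʳ-∧ x y z = trans (+-comm (x ∧ y) z) (trans (+-distrib-∧ z x y) (cong₂ _∧_ (+-comm z x) (+-comm z y)))

  +-distribʳ-∨ : ∀ x y z → (x ∨ y) + z ≡ (x + z) ∨ (y + z)
  +-distribʳ-∨ x y z = trans (+-comm (x ∨ y) z) (trans (+-distrib-∨ z x y) (cong₂ _∨_ (+-comm z x) (+-comm z y)))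

  +-monoʳ-≤ : ∀ z {x y} → x ≤ y → z + x ≤ z + y
  +-monoʳ-≤ z {x} {y} x≤y = trans (sym (+-distrib-∧ z x y)) (cong (z +_) x≤y)

  +-monoˡ-≤ : ∀ z {x y} → x ≤ y → x + z ≤ y + z
  +-monoˡ-≤ z {x} {y} x≤y = subst₂ _≤_ (+-comm z x) (+-comm z y) (+-monoʳ-≤ z x≤y)

  x∧y+x∨y≡x+y : ∀ x y → (x ∧ y) + (x ∨ y) ≡ x + y
  x∧y+x∨y≡x+y x y = ≤-antisym ≤x+y ≥x+y
    where
    ≤x+y : (x ∧ y) + (x ∨ y) ≤ x + y
    ≤x+y = subst (_≤ x + y) (sym (+-distrib-∨ (x ∧ y) x y))
      (∨-least (subst ((x ∧ y) + x ≤_) (+-comm y x) (+-monoˡ-≤ x (x∧y≤y x y)))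
               (+-monoˡ-≤ y (x∧y≤x x y)))
    ≥x+y : x + y ≤ (x ∧ y) + (x ∨ y)
    ≥x+y = subst (x + y ≤_) (trans (sym (+-distrib-∧ (x ∨ y) x y)) (+-comm (x ∨ y) (x ∧ y)))
      (∧-greatest (subst (_≤ (x ∨ y) + x) (+-comm y x) (+-monoˡ-≤ x (y≤x∨y x y)))
                  (+-monoˡ-≤ y (x≤x∨y x y)))

  Cancellable : M → Set a
  Cancellable z = ∀ x y → x + z ≡ y + z → x ≡ y

  invertible⇒cancellable : ∀ {z w} → z + w ≡ 𝟘 → Cancellable z
  invertible⇒cancellable {z} {w} z+w≡𝟘 x y x+z≡y+z = begin
    x              ≡⟨ +-identityʳ x ⟨
    x + 𝟘          ≡⟨ cong (x +_) z+w≡𝟘 ⟨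
    x + (z + w)    ≡⟨ +-assoc x z w ⟨
    (x + z) + w    ≡⟨ cong (_+ w) x+z≡y+z ⟩
    (y + z) + w    ≡⟨ +-assoc y z w ⟩
    y + (z + w)    ≡⟨ cong (y +_) z+w≡𝟘 ⟩
    y + 𝟘          ≡⟨ +-identityʳ y ⟩
    y              ∎

  cancellable-+ : ∀ {u v} → Cancellable u → Cancellable v → Cancellable (u + v)
  cancellable-+ {u} {v} cu cv x y eq =
    cu x y (cv (x + u) (y + u) (trans (+-assoc x u v) (trans eq (sym (+-assoc y u v)))))

  cancellable-+⇒cancellableˡ : ∀ {u v} → Cancellable (u + v) → Cancellable u
  cancellable-+⇒cancellableˡ {u} {v} cuv x y eq =
    cuv x y (trans (sym (+-assoc x u v)) (trans (cong (_+ v) eq) (+-assoc y u v)))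

  infixr 8 _·_
  _·_ : ℕ → M → M
  n · x = times _+_ 𝟘 n x

  ·-homo-+ : ∀ m n x → (m +ℕ n) · x ≡ m · x + n · x
  ·-homo-+ zero    n x = sym (+-identityˡ (n · x))
  ·-homo-+ (suc m) n x = trans (cong (x +_) (·-homo-+ m n x)) (sym (+-assoc x (m · x) (n · x)))

  n·-𝟙+n·𝟙≡𝟘 : ∀ n → n · -𝟙 + n · 𝟙 ≡ 𝟘
  n·-𝟙+n·𝟙≡𝟘 zero    = +-identityˡ 𝟘
  n·-𝟙+n·𝟙≡𝟘 (suc n) = begin
    (-𝟙 + n · -𝟙) + (𝟙 + n · 𝟙)  ≡⟨ interchange -𝟙 (n · -𝟙) 𝟙 (n · 𝟙) ⟩
    (-𝟙 + 𝟙) + (n · -𝟙 + n · 𝟙)  ≡⟨ cong₂ _+_ -𝟙+𝟙 (n·-𝟙+n·𝟙≡𝟘 n) ⟩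
    𝟘 + 𝟘                        ≡⟨ +-identityˡ 𝟘 ⟩
    𝟘                            ∎

  n·𝟙+n·-𝟙≡𝟘 : ∀ n → n · 𝟙 + n · -𝟙 ≡ 𝟘
  n·𝟙+n·-𝟙≡𝟘 n = trans (+-comm (n · 𝟙) (n · -𝟙)) (n·-𝟙+n·𝟙≡𝟘 n)

  𝟘≤n·𝟙 : ∀ n → 𝟘 ≤ n · 𝟙
  𝟘≤n·𝟙 zero    = ∧-idem 𝟘
  𝟘≤n·𝟙 (suc n) = ≤-trans (subst (_≤ 𝟙 + 𝟘) (+-identityˡ 𝟘) (+-monoˡ-≤ 𝟘 𝟘≤𝟙)) (+-monoʳ-≤ 𝟙 (𝟘≤n·𝟙 n))

  n·-𝟙≤𝟘 : ∀ n → n · -𝟙 ≤ 𝟘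
  n·-𝟙≤𝟘 zero    = ∧-idem 𝟘
  n·-𝟙≤𝟘 (suc n) = ≤-trans (+-monoʳ-≤ -𝟙 (n·-𝟙≤𝟘 n)) (subst (-𝟙 + 𝟘 ≤_) (+-identityˡ 𝟘) (+-monoˡ-≤ 𝟘 -𝟙≤𝟘))

  infix 4 _∈[_,_]
  _∈[_,_] : M → M → M → Set a
  x ∈[ l , u ] = l ≤ x × x ≤ u

  ∈[-k,k]-weaken : ∀ k l {x} → x ∈[ k · -𝟙 , k · 𝟙 ] → x ∈[ (k +ℕ l) · -𝟙 , (k +ℕ l) · 𝟙 ]
  ∈[-k,k]-weaken k l (lo , hi) =
    ≤-trans (subst₂ _≤_ (sym (·-homo-+ k l -𝟙)) (+-identityʳ (k · -𝟙)) (+-monoʳ-≤ (k · -𝟙) (n·-𝟙≤𝟘 l))) lo ,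
    ≤-trans hi (subst₂ _≤_ (+-identityʳ (k · 𝟙)) (sym (·-homo-+ k l 𝟙)) (+-monoʳ-≤ (k · 𝟙) (𝟘≤n·𝟙 l)))

  bounded : ∀ x → ∃ λ k → x ∈[ k · -𝟙 , k · 𝟙 ]
  bounded x with unital x
  ... | n , lo , hi = suc n , lo , hi

  bounded₂ : ∀ x y → ∃ λ k → x ∈[ k · -𝟙 , k · 𝟙 ] × y ∈[ k · -𝟙 , k · 𝟙 ]
  bounded₂ x y with bounded x | bounded y
  ... | kx , x∈ | ky , y∈ =
    kx +ℕ ky , ∈[-k,k]-weaken kx ky x∈ ,
    subst (λ k → y ∈[ k · -𝟙 , k · 𝟙 ]) (+ℕ-comm ky kx) (∈[-k,k]-weaken ky kx y∈)

  shift-∈[𝟘,2k] : ∀ k {x} → x ∈[ k · -𝟙 , k · 𝟙 ] → x + k · 𝟙 ∈[ 𝟘 , (k +ℕ k) · 𝟙 ]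
  shift-∈[𝟘,2k] k {x} (lo , hi) =
    subst (_≤ x + k · 𝟙) (n·-𝟙+n·𝟙≡𝟘 k) (+-monoˡ-≤ (k · 𝟙) lo) ,
    subst (x + k · 𝟙 ≤_) (sym (·-homo-+ k k 𝟙)) (+-monoˡ-≤ (k · 𝟙) hi)

  𝟙+-𝟙≡𝟘 : 𝟙 + -𝟙 ≡ 𝟘
  𝟙+-𝟙≡𝟘 = trans (+-comm 𝟙 -𝟙) -𝟙+𝟙

  infix 9 _⁺
  _⁺ : M → M
  x ⁺ = x ∨ 𝟘

  [x+p]⁺+z : ∀ x p z → (x + p) ⁺ + z ≡ ((x + z) + p) ∨ (𝟘 + z)
  [x+p]⁺+z x p z = trans (+-distribʳ-∨ (x + p) 𝟘 z) (cong (_∨ (𝟘 + z)) (xy∙z≈xz∙y x p z))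

  [x+p]⁺+q≡x∨q : ∀ x {p q} → p + q ≡ 𝟘 → (x + p) ⁺ + q ≡ x ∨ q
  [x+p]⁺+q≡x∨q x {p} {q} p+q≡𝟘 = begin
    (x + p) ⁺ + q            ≡⟨ [x+p]⁺+z x p q ⟩
    ((x + q) + p) ∨ (𝟘 + q)  ≡⟨ cong₂ _∨_ (sym (xy∙z≈xz∙y x p q)) (+-identityˡ q) ⟩
    ((x + p) + q) ∨ q        ≡⟨ cong (_∨ q) (trans (+-assoc x p q) (cong (x +_) p+q≡𝟘)) ⟩
    (x + 𝟘) ∨ q              ≡⟨ cong (_∨ q) (+-identityʳ x) ⟩
    x ∨ q                    ∎

  [x+p]⁺≤v : ∀ {x u v p} → 𝟘 ≤ v → x ≤ u + v → u + p ≡ 𝟘 → (x + p) ⁺ ≤ v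
  [x+p]⁺≤v {x} {u} {v} {p} 𝟘≤v x≤u+v u+p≡𝟘 = ∨-least x+p≤v 𝟘≤v
    where
    x+p≤v : x + p ≤ v
    x+p≤v = subst (x + p ≤_)
      (trans (xy∙z≈xz∙y u v p) (trans (cong (_+ v) u+p≡𝟘) (+-identityˡ v)))
      (+-monoˡ-≤ p x≤u+v)

  z∧𝟙+[z-𝟙]⁺≡z : ∀ z → (z ∧ 𝟙) + (z + -𝟙) ⁺ ≡ z
  z∧𝟙+[z-𝟙]⁺≡z z = invertible⇒cancellable 𝟙+-𝟙≡𝟘 _ z (begin
    ((z ∧ 𝟙) + (z + -𝟙) ⁺) + 𝟙  ≡⟨ +-assoc (z ∧ 𝟙) ((z + -𝟙) ⁺) 𝟙 ⟩
    (z ∧ 𝟙) + ((z + -𝟙) ⁺ + 𝟙)  ≡⟨ cong ((z ∧ 𝟙) +_) ([x+p]⁺+q≡x∨q z -𝟙+𝟙) ⟩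
    (z ∧ 𝟙) + (z ∨ 𝟙)           ≡⟨ x∧y+x∨y≡x+y z 𝟙 ⟩
    z + 𝟙                     ∎)

  module _ (cancellativeOnUnit : CancellativeOnUnit) where

    cancel-∈[𝟘,n] : ∀ n {x y z} → InΓ z → x ∈[ 𝟘 , n · 𝟙 ] → y ∈[ 𝟘 , n · 𝟙 ] → x + z ≡ y + z → x ≡ y
    cancel-∈[𝟘,n] zero    _ (𝟘≤x , x≤𝟘) (𝟘≤y , y≤𝟘) _ = trans (≤-antisym x≤𝟘 𝟘≤x) (≤-antisym 𝟘≤y y≤𝟘)
    cancel-∈[𝟘,n] (suc n) {x} {y} {z} z∈Γ (𝟘≤x , x≤) (𝟘≤y , y≤) x+z≡y+z = ∧-∨-cancel meets-equal joins-equal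
      where
      N = n · 𝟙
      Ň = n · -𝟙
      meet-∈[𝟘,N] : ∀ {u} → 𝟘 ≤ u → u ∧ N ∈[ 𝟘 , N ]
      meet-∈[𝟘,N] 𝟘≤u = ∧-greatest 𝟘≤u (𝟘≤n·𝟙 n) , x∧y≤y _ N
      rest-∈Γ : ∀ {u} → u ≤ 𝟙 + N → InΓ ((u + Ň) ⁺)
      rest-∈Γ {u} u≤ = y≤x∨y (u + Ň) 𝟘 , [x+p]⁺≤v 𝟘≤𝟙 (subst (u ≤_) (+-comm 𝟙 N) u≤) (n·𝟙+n·-𝟙≡𝟘 n)
      meets-equal : x ∧ N ≡ y ∧ N
      meets-equal = cancel-∈[𝟘,n] n z∈Γ (meet-∈[𝟘,N] 𝟘≤x) (meet-∈[𝟘,N] 𝟘≤y) (begin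
        (x ∧ N) + z         ≡⟨ +-distribʳ-∧ x N z ⟩
        (x + z) ∧ (N + z)  ≡⟨ cong (_∧ (N + z)) x+z≡y+z ⟩
        (y + z) ∧ (N + z)  ≡⟨ +-distribʳ-∧ y N z ⟨
        (y ∧ N) + z         ∎)
      rests-equal : (x + Ň) ⁺ ≡ (y + Ň) ⁺
      rests-equal = cancellativeOnUnit _ _ z (rest-∈Γ x≤) (rest-∈Γ y≤) z∈Γ (begin
        (x + Ň) ⁺ + z            ≡⟨ [x+p]⁺+z x Ň z ⟩
        ((x + z) + Ň) ∨ (𝟘 + z)  ≡⟨ cong (λ w → (w + Ň) ∨ (𝟘 + z)) x+z≡y+z ⟩
        ((y + z) + Ň) ∨ (𝟘 + z)  ≡⟨ [x+p]⁺+z y Ň z ⟨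
        (y + Ň) ⁺ + z            ∎)
      joins-equal : x ∨ N ≡ y ∨ N
      joins-equal = begin
        x ∨ N          ≡⟨ [x+p]⁺+q≡x∨q x (n·-𝟙+n·𝟙≡𝟘 n) ⟨
        (x + Ň) ⁺ + N  ≡⟨ cong (_+ N) rests-equal ⟩
        (y + Ň) ⁺ + N  ≡⟨ [x+p]⁺+q≡x∨q y (n·-𝟙+n·𝟙≡𝟘 n) ⟩
        y ∨ N          ∎

    InΓ⇒cancellable : ∀ {z} → InΓ z → Cancellable z
    InΓ⇒cancellable {z} z∈Γ x y x+z≡y+z with bounded₂ x y
    ... | k , x∈ , y∈ = invertible⇒cancellable (n·𝟙+n·-𝟙≡𝟘 k) x y
      (cancel-∈[𝟘,n] (k +ℕ k) z∈Γ (shift-∈[𝟘,2k] k x∈) (shift-∈[𝟘,2k] k y∈) (begin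
        (x + k · 𝟙) + z  ≡⟨ xy∙z≈xz∙y x (k · 𝟙) z ⟩
        (x + z) + k · 𝟙  ≡⟨ cong (_+ k · 𝟙) x+z≡y+z ⟩
        (y + z) + k · 𝟙  ≡⟨ xy∙z≈xz∙y y (k · 𝟙) z ⟨
        (y + k · 𝟙) + z  ∎))

  module _ (InΓ⇒cancellable : ∀ {z} → InΓ z → Cancellable z) where

    ∈[𝟘,n]⇒cancellable : ∀ n {z} → z ∈[ 𝟘 , n · 𝟙 ] → Cancellable z
    ∈[𝟘,n]⇒cancellable zero (𝟘≤z , z≤𝟘) =
      subst Cancellable (≤-antisym 𝟘≤z z≤𝟘) (invertible⇒cancellable (+-identityˡ 𝟘))
    ∈[𝟘,n]⇒cancellable (suc n) {z} (𝟘≤z , z≤) = subst Cancellable (z∧𝟙+[z-𝟙]⁺≡z z)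
      (cancellable-+ (InΓ⇒cancellable (∧-greatest 𝟘≤z 𝟘≤𝟙 , x∧y≤y z 𝟙))
                     (∈[𝟘,n]⇒cancellable n (y≤x∨y (z + -𝟙) 𝟘 , [x+p]⁺≤v (𝟘≤n·𝟙 n) z≤ 𝟙+-𝟙≡𝟘)))

    cancellable : ∀ z → Cancellable z
    cancellable z with bounded z
    ... | k , z∈ = cancellable-+⇒cancellableˡ (∈[𝟘,n]⇒cancellable (k +ℕ k) (shift-∈[𝟘,2k] k z∈))

  cancellative⇒cancellativeOnUnit : Cancellative → CancellativeOnUnit
  cancellative⇒cancellativeOnUnit cancel x y z _ _ _ = cancel x y z

  cancellativeOnUnit⇒Γcancellative : CancellativeOnUnit → ΓCancellative
  cancellativeOnUnit⇒Γcancellative cancel x y z x∈Γ y∈Γ z∈Γ ⊕-eq ⊙-eq =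
    cancel x y z x∈Γ y∈Γ z∈Γ (∧-∨-cancel ⊕-eq (begin
      (x + z) ∨ 𝟙            ≡⟨ [x+p]⁺+q≡x∨q (x + z) -𝟙+𝟙 ⟨
      (x ⊙ z) + 𝟙            ≡⟨ cong (_+ 𝟙) ⊙-eq ⟩
      (y ⊙ z) + 𝟙            ≡⟨ [x+p]⁺+q≡x∨q (y + z) -𝟙+𝟙 ⟩
      (y + z) ∨ 𝟙            ∎))

  Γcancellative⇒cancellativeOnUnit : ΓCancellative → CancellativeOnUnit
  Γcancellative⇒cancellativeOnUnit cancel x y z x∈Γ y∈Γ z∈Γ x+z≡y+z =
    cancel x y z x∈Γ y∈Γ z∈Γ (cong (_∧ 𝟙) x+z≡y+z) (cong (λ w → (w + -𝟙) ⁺) x+z≡y+z)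

  cancellativeOnUnit⇒cancellative : CancellativeOnUnit → Cancellative
  cancellativeOnUnit⇒cancellative cancel x y z = cancellable (InΓ⇒cancellable cancel) z x y

proposition4p2 : ∀ {a : Level} (𝐌 : UCDLMonoid a) →
    TFAE₃ (UCDLMonoid.Cancellative 𝐌) (UCDLMonoid.CancellativeOnUnit 𝐌) (UCDLMonoid.ΓCancellative 𝐌)
proposition4p2 𝐌 =
  (cancellative⇒cancellativeOnUnit , cancellativeOnUnit⇒Γcancellative) ,
  cancellativeOnUnit⇒cancellative ∘ Γcancellative⇒cancellativeOnUnit
  where open UCDLMonoidProperties 𝐌
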